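{- Let $p_1 < p_2 < \cdots$ denote the prime numbers in increasing order. For $k \ge 1$ let $f_k = (-1)^k \det M_k$, where $M_k$ is the $(k+1)\times(k+1)$ matrix whose first row consists entirely of ones and, for $1 \le i \le k$, whose row $i+1$ has entry $p_i$ in column $i$ and entry $1$ in every other column. Then for every $k \ge 2$, $$f_k = (p_k - 1) f_{k-1}.$$ -}

module Defs where

open import Data.Nat as ℕ using (ℕ; zero; suc; _<_)
open import Data.Nat.Primality using (Prime)
open import Data.Fin using (Fin; zero; suc; punchIn; inject₁; _≟_)
open import Data.Integer as ℤ using (ℤ; +_; -1ℤ; 1ℤ; 0ℤ; _*_; _+_; _^_)
open import Data.Product using (∃; _×_)
open import Relation.Nullary using (yes; no)
open import Relation.Binary.PropositionalEquality using (_≡_)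

Matrix : ℕ → Set
Matrix n = Fin n → Fin n → ℤ

sumFin : ∀ n → (Fin n → ℤ) → ℤ
sumFin zero    f = 0ℤ
sumFin (suc n) f = f zero + sumFin n (λ i → f (suc i))

det : ∀ n → Matrix n → ℤ
det zero    A = 1ℤ
det (suc n) A =
  sumFin (suc n) λ j → (-1ℤ ^ Data.Fin.toℕ j) * A zero j * det n (λ i l → A (suc i) (punchIn j l))

-- pr i is the (i+1)-th prime, i.e. pr i = p_{i+1} (0-based indexing).
-- "pr enumerates the primes in increasing order":
IsPrimeEnumeration : (ℕ → ℕ) → Set
IsPrimeEnumeration pr =
  (∀ i j → i < j → pr i < pr j) ×
  (∀ i → Prime (pr i)) ×
  (∀ q → Prime q → ∃ λ i → pr i ≡ q)

-- M_k : the (k+1)×(k+1) matrix.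
-- Row 0 is all ones; row (suc i) (0-based) has p_{i+1} = pr i in
-- column i (0-based) and 1 elsewhere (paper: row i+1 has p_i in column i, 1-based).
M : (ℕ → ℕ) → ∀ k → Matrix (suc k)
M pr k zero    c = 1ℤ
M pr k (suc i) c with c ≟ inject₁ i
... | yes _ = + pr (Data.Fin.toℕ i)
... | no  _ = 1ℤ

f : (ℕ → ℕ) → ℕ → ℤ
f pr k = (-1ℤ ^ k) * det (suc k) (M pr k)

-- Writing the first row of M_{k+1} as (row 2) + (1 − p₁)·e₀ and expanding linearly,
-- the part with two equal rows vanishes and the part with first row e₀ is the
-- minor at (0, 0), which is M_k for the shifted sequence p₂, p₃, …. Hence
-- det M_{k+1} = (1 − p₁) det M_k and f_k = (p₁ − 1)(p₂ − 1)⋯(p_k − 1), which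
-- gives the recurrence.
module Submission where

open import Defs
open import Data.Nat using (ℕ; zero; suc; _≤_; _∸_; s≤s; z≤n)
open import Data.Integer using (ℤ; +_; _-_; _+_; _*_; -_; _^_; 0ℤ; 1ℤ; -1ℤ)
open import Data.Integer.Properties
  using (+-assoc; +-identityˡ; +-identityʳ; +-inverseʳ; *-zeroʳ; *-distribˡ-+;
         *-identityˡ; *-identityʳ; *-assoc; *-comm)
open import Data.Integer.Tactic.RingSolver using (solve-∀)
open import Data.Fin as Fin using (Fin; toℕ; punchIn; inject₁; _≟_)
open import Data.Fin.Properties using (toℕ-inject₁)
open import Data.Vec.Functional using (_∷_)
open import Function using (_∘_)
open import Relation.Nullary using (yes; no)
open import Relation.Binary.PropositionalEquality
  using (_≡_; refl; sym; trans; cong; cong₂; module ≡-Reasoning)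
open ≡-Reasoning

sumFin-cong : ∀ n {g h : Fin n → ℤ} → (∀ i → g i ≡ h i) → sumFin n g ≡ sumFin n h
sumFin-cong zero    g≡h = refl
sumFin-cong (suc n) g≡h = cong₂ _+_ (g≡h Fin.zero) (sumFin-cong n (g≡h ∘ Fin.suc))

sumFin-zero : ∀ n → sumFin n (λ _ → 0ℤ) ≡ 0ℤ
sumFin-zero zero    = refl
sumFin-zero (suc n) = trans (+-identityˡ _) (sumFin-zero n)

sumFin-distrib-+ : ∀ n (g h : Fin n → ℤ) → sumFin n (λ i → g i + h i) ≡ sumFin n g + sumFin n h
sumFin-distrib-+ zero    g h = refl
sumFin-distrib-+ (suc n) g h = begin
  g₀ + h₀ + sumFin n (λ i → g (Fin.suc i) + h (Fin.suc i))
    ≡⟨ cong (λ z → g₀ + h₀ + z) (sumFin-distrib-+ n (g ∘ Fin.suc) (h ∘ Fin.suc)) ⟩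
  g₀ + h₀ + (G + H)
    ≡⟨ interchange g₀ h₀ G H ⟩
  g₀ + G + (h₀ + H) ∎
  where
  g₀ h₀ G H : ℤ
  g₀ = g Fin.zero
  h₀ = h Fin.zero
  G = sumFin n (g ∘ Fin.suc)
  H = sumFin n (h ∘ Fin.suc)
  interchange : ∀ a b c d → a + b + (c + d) ≡ a + c + (b + d)
  interchange = solve-∀

*-distribˡ-sumFin : ∀ n x (g : Fin n → ℤ) → x * sumFin n g ≡ sumFin n (λ i → x * g i)
*-distribˡ-sumFin zero    x g = *-zeroʳ x
*-distribˡ-sumFin (suc n) x g =
  trans (*-distribˡ-+ x (g Fin.zero) (sumFin n (g ∘ Fin.suc)))
        (cong (λ z → x * g Fin.zero + z) (*-distribˡ-sumFin n x (g ∘ Fin.suc)))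

-- F j l is the term of the ordered pair of distinct positions (j, punchIn j l);
-- the hypothesis says that swapping the pair negates the term.
sumFin-antisymmetric : ∀ n (F : Fin (suc n) → Fin n → ℤ) →
                       (∀ l m → l Fin.≤ m → F (Fin.suc m) l ≡ - F (inject₁ l) m) →
                       sumFin (suc n) (λ j → sumFin n (F j)) ≡ 0ℤ
sumFin-antisymmetric zero    F antisym = refl
sumFin-antisymmetric (suc n) F antisym = begin
  Row₀ + sumFin (suc n) (λ j → F (Fin.suc j) Fin.zero + sumFin n (F (Fin.suc j) ∘ Fin.suc))
    ≡⟨ cong (λ z → Row₀ + z)
            (sumFin-distrib-+ (suc n) (λ j → F (Fin.suc j) Fin.zero) (λ j → sumFin n (F (Fin.suc j) ∘ Fin.suc))) ⟩
  Row₀ + (Col₀ + Rest)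
    ≡⟨ sym (+-assoc Row₀ Col₀ Rest) ⟩
  Row₀ + Col₀ + Rest
    ≡⟨ cong₂ _+_ (sym (sumFin-distrib-+ (suc n) (F Fin.zero) (λ l → F (Fin.suc l) Fin.zero)))
                 (sumFin-antisymmetric n (λ j l → F (Fin.suc j) (Fin.suc l)) antisym′) ⟩
  sumFin (suc n) (λ l → F Fin.zero l + F (Fin.suc l) Fin.zero) + 0ℤ
    ≡⟨ +-identityʳ _ ⟩
  sumFin (suc n) (λ l → F Fin.zero l + F (Fin.suc l) Fin.zero)
    ≡⟨ sumFin-cong (suc n) cancel ⟩
  sumFin (suc n) (λ _ → 0ℤ)
    ≡⟨ sumFin-zero (suc n) ⟩
  0ℤ ∎
  where
  Row₀ Col₀ Rest : ℤ
  Row₀ = sumFin (suc n) (F Fin.zero)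
  Col₀ = sumFin (suc n) (λ j → F (Fin.suc j) Fin.zero)
  Rest = sumFin (suc n) (λ j → sumFin n (F (Fin.suc j) ∘ Fin.suc))
  antisym′ : ∀ l m → l Fin.≤ m → F (Fin.suc (Fin.suc m)) (Fin.suc l) ≡ - F (Fin.suc (inject₁ l)) (Fin.suc m)
  antisym′ l m l≤m = antisym (Fin.suc l) (Fin.suc m) (s≤s l≤m)
  cancel : ∀ l → F Fin.zero l + F (Fin.suc l) Fin.zero ≡ 0ℤ
  cancel l = trans (cong (λ z → F Fin.zero l + z) (antisym Fin.zero l z≤n)) (+-inverseʳ (F Fin.zero l))

punchIn-below : ∀ {n} {l m : Fin n} → l Fin.≤ m → punchIn (Fin.suc m) l ≡ inject₁ l
punchIn-below {l = Fin.zero}                 _         = refl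
punchIn-below {l = Fin.suc l} {m = Fin.suc m} (s≤s l≤m) = cong Fin.suc (punchIn-below l≤m)

punchIn-above : ∀ {n} {l m : Fin n} → l Fin.≤ m → punchIn (inject₁ l) m ≡ Fin.suc m
punchIn-above {l = Fin.zero}                 _         = refl
punchIn-above {l = Fin.suc l} {m = Fin.suc m} (s≤s l≤m) = cong Fin.suc (punchIn-above l≤m)

punchIn-comm : ∀ {n} {l m : Fin (suc n)} → l Fin.≤ m → ∀ c →
               punchIn (Fin.suc m) (punchIn l c) ≡ punchIn (inject₁ l) (punchIn m c)
punchIn-comm {l = Fin.zero}                 _         c           = refl
punchIn-comm {l = Fin.suc l} {m = Fin.suc m} (s≤s l≤m) Fin.zero    = refl
punchIn-comm {l = Fin.suc l} {m = Fin.suc m} (s≤s l≤m) (Fin.suc c) = cong Fin.suc (punchIn-comm l≤m c)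

sign : ∀ {n} → Fin n → ℤ
sign j = -1ℤ ^ toℕ j

minor : ∀ {m n} → Fin (suc n) → (Fin m → Fin (suc n) → ℤ) → Fin m → Fin n → ℤ
minor j R i l = R i (punchIn j l)

det-cong : ∀ n {A B : Matrix n} → (∀ i j → A i j ≡ B i j) → det n A ≡ det n B
det-cong zero    A≡B = refl
det-cong (suc n) A≡B = sumFin-cong (suc n) λ j →
  cong₂ (λ a d → sign j * a * d) (A≡B Fin.zero j) (det-cong n λ i l → A≡B (Fin.suc i) (punchIn j l))

det-linear-head : ∀ n (x y : Fin (suc n) → ℤ) t (R : Fin n → Fin (suc n) → ℤ) →
                  det (suc n) ((λ c → x c + t * y c) ∷ R) ≡ det (suc n) (x ∷ R) + t * det (suc n) (y ∷ R)
det-linear-head n x y t R = begin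
  det (suc n) ((λ c → x c + t * y c) ∷ R)
    ≡⟨ sumFin-cong (suc n) (λ j → expand (sign j) (x j) t (y j) (det n (minor j R))) ⟩
  sumFin (suc n) (λ j → cofactor x j + t * cofactor y j)
    ≡⟨ sumFin-distrib-+ (suc n) (cofactor x) (λ j → t * cofactor y j) ⟩
  det (suc n) (x ∷ R) + sumFin (suc n) (λ j → t * cofactor y j)
    ≡⟨ cong (λ z → det (suc n) (x ∷ R) + z) (sym (*-distribˡ-sumFin (suc n) t (cofactor y))) ⟩
  det (suc n) (x ∷ R) + t * det (suc n) (y ∷ R) ∎
  where
  cofactor : (Fin (suc n) → ℤ) → Fin (suc n) → ℤ
  cofactor z j = sign j * z j * det n (minor j R)
  expand : ∀ s a t b d → s * (a + t * b) * d ≡ s * a * d + t * (s * b * d)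
  expand = solve-∀

det-repeated-head : ∀ n (x : Fin (suc (suc n)) → ℤ) (R : Fin n → Fin (suc (suc n)) → ℤ) →
                    det (suc (suc n)) (x ∷ x ∷ R) ≡ 0ℤ
det-repeated-head n x R = begin
  det (suc (suc n)) (x ∷ x ∷ R)
    ≡⟨ sumFin-cong (suc (suc n)) (λ j →
         *-distribˡ-sumFin (suc n) (sign j * x j) (λ l → sign l * x (punchIn j l) * D j l)) ⟩
  sumFin (suc (suc n)) (λ j → sumFin (suc n) (F j))
    ≡⟨ sumFin-antisymmetric (suc n) F antisym ⟩
  0ℤ ∎
  where
  D : Fin (suc (suc n)) → Fin (suc n) → ℤ
  D j l = det n (minor l (minor j R))
  F : Fin (suc (suc n)) → Fin (suc n) → ℤ
  F j l = sign j * x j * (sign l * x (punchIn j l) * D j l)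
  swap-factors : ∀ a b u v d → -1ℤ * a * v * (b * u * d) ≡ - (b * u * (a * v * d))
  swap-factors = solve-∀
  antisym : ∀ l m → l Fin.≤ m → F (Fin.suc m) l ≡ - F (inject₁ l) m
  antisym l m l≤m = begin
    sign (Fin.suc m) * x (Fin.suc m) * (sign l * x (punchIn (Fin.suc m) l) * D (Fin.suc m) l)
      ≡⟨ cong₂ (λ u d → sign (Fin.suc m) * x (Fin.suc m) * (sign l * u * d))
               (cong x (punchIn-below l≤m)) (det-cong n λ i c → cong (R i) (punchIn-comm l≤m c)) ⟩
    -1ℤ * sign m * x (Fin.suc m) * (sign l * x (inject₁ l) * D (inject₁ l) m)
      ≡⟨ swap-factors (sign m) (sign l) (x (inject₁ l)) (x (Fin.suc m)) (D (inject₁ l) m) ⟩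
    - (sign l * x (inject₁ l) * (sign m * x (Fin.suc m) * D (inject₁ l) m))
      ≡⟨ cong₂ (λ s v → - (s * x (inject₁ l) * (sign m * v * D (inject₁ l) m)))
               (cong (-1ℤ ^_) (sym (toℕ-inject₁ l))) (cong x (sym (punchIn-above l≤m))) ⟩
    - F (inject₁ l) m ∎

δ₀ : ∀ {n} → Fin (suc n) → ℤ
δ₀ Fin.zero    = 1ℤ
δ₀ (Fin.suc _) = 0ℤ

det-δ₀-head : ∀ n (R : Fin n → Fin (suc n) → ℤ) → det (suc n) (δ₀ ∷ R) ≡ det n (minor Fin.zero R)
det-δ₀-head n R = trans (cong₂ _+_ (*-identityˡ (det n (minor Fin.zero R))) vanishing) (+-identityʳ _)
  where
  zero-term : ∀ s d → s * 0ℤ * d ≡ 0ℤ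
  zero-term = solve-∀
  vanishing : sumFin n (λ j → sign (Fin.suc j) * 0ℤ * det n (minor (Fin.suc j) R)) ≡ 0ℤ
  vanishing = trans (sumFin-cong n λ j → zero-term (sign (Fin.suc j)) (det n (minor (Fin.suc j) R)))
                    (sumFin-zero n)

M-minor₀ : ∀ pr k i l → M pr (suc k) (Fin.suc (Fin.suc i)) (Fin.suc l) ≡ M (pr ∘ suc) k (Fin.suc i) l
M-minor₀ pr k i l with l ≟ inject₁ i
... | yes _ = refl
... | no  _ = refl

det-M-suc : ∀ pr k → det (suc (suc k)) (M pr (suc k)) ≡ (1ℤ - + pr 0) * det (suc k) (M (pr ∘ suc) k)
det-M-suc pr k = begin
  det (suc (suc k)) (M pr (suc k))
    ≡⟨ det-cong (suc (suc k)) rows ⟩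
  det (suc (suc k)) ((λ c → r c + t * δ₀ c) ∷ r ∷ R)
    ≡⟨ det-linear-head (suc k) r δ₀ t (r ∷ R) ⟩
  det (suc (suc k)) (r ∷ r ∷ R) + t * det (suc (suc k)) (δ₀ ∷ r ∷ R)
    ≡⟨ cong₂ (λ a b → a + t * b) (det-repeated-head k r R) (det-δ₀-head (suc k) (r ∷ R)) ⟩
  0ℤ + t * det (suc k) (minor Fin.zero (r ∷ R))
    ≡⟨ +-identityˡ _ ⟩
  t * det (suc k) (minor Fin.zero (r ∷ R))
    ≡⟨ cong (t *_) (det-cong (suc k) minor₀) ⟩
  t * det (suc k) (M (pr ∘ suc) k) ∎
  where
  r : Fin (suc (suc k)) → ℤ
  r = M pr (suc k) (Fin.suc Fin.zero)
  R : Fin k → Fin (suc (suc k)) → ℤ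
  R i = M pr (suc k) (Fin.suc (Fin.suc i))
  t : ℤ
  t = 1ℤ - + pr 0
  first-entry : ∀ p → 1ℤ ≡ p + (1ℤ - p) * 1ℤ
  first-entry = solve-∀
  first-row : ∀ c → 1ℤ ≡ r c + t * δ₀ c
  first-row Fin.zero    = first-entry (+ pr 0)
  first-row (Fin.suc c) = sym (cong (λ z → 1ℤ + z) (*-zeroʳ t))
  rows : ∀ i c → M pr (suc k) i c ≡ ((λ c → r c + t * δ₀ c) ∷ r ∷ R) i c
  rows Fin.zero              c = first-row c
  rows (Fin.suc Fin.zero)    c = refl
  rows (Fin.suc (Fin.suc i)) c = refl
  minor₀ : ∀ i l → minor Fin.zero (r ∷ R) i l ≡ M (pr ∘ suc) k i l
  minor₀ Fin.zero    l = refl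
  minor₀ (Fin.suc i) l = M-minor₀ pr k i l

∏ : ℕ → (ℕ → ℤ) → ℤ
∏ zero    g = 1ℤ
∏ (suc n) g = g 0 * ∏ n (g ∘ suc)

∏-suc : ∀ n g → ∏ (suc n) g ≡ ∏ n g * g n
∏-suc zero    g = trans (*-identityʳ (g 0)) (sym (*-identityˡ (g 0)))
∏-suc (suc n) g = trans (cong (g 0 *_) (∏-suc n (g ∘ suc))) (sym (*-assoc (g 0) _ _))

f≡∏ : ∀ pr k → f pr k ≡ ∏ k (λ i → + pr i - 1ℤ)
f≡∏ pr zero    = refl
f≡∏ pr (suc k) = begin
  -1ℤ ^ suc k * det (suc (suc k)) (M pr (suc k))
    ≡⟨ cong (-1ℤ ^ suc k *_) (det-M-suc pr k) ⟩
  -1ℤ * -1ℤ ^ k * ((1ℤ - + pr 0) * det (suc k) (M (pr ∘ suc) k))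
    ≡⟨ sign-flip (-1ℤ ^ k) (+ pr 0) (det (suc k) (M (pr ∘ suc) k)) ⟩
  (+ pr 0 - 1ℤ) * f (pr ∘ suc) k
    ≡⟨ cong ((+ pr 0 - 1ℤ) *_) (f≡∏ (pr ∘ suc) k) ⟩
  ∏ (suc k) (λ i → + pr i - 1ℤ) ∎
  where
  sign-flip : ∀ s p d → -1ℤ * s * ((1ℤ - p) * d) ≡ (p - 1ℤ) * (s * d)
  sign-flip = solve-∀

-- The recurrence holds for every sequence of naturals.
lemma1 : (pr : ℕ → ℕ) → IsPrimeEnumeration pr →
         ∀ k → 2 ≤ k → f pr k ≡ (+ pr (k ∸ 1) - 1ℤ) * f pr (k ∸ 1)
lemma1 pr _ (suc k) _ = begin
  f pr (suc k)       ≡⟨ f≡∏ pr (suc k) ⟩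
  ∏ (suc k) φ        ≡⟨ ∏-suc k φ ⟩
  ∏ k φ * φ k        ≡⟨ *-comm (∏ k φ) (φ k) ⟩
  φ k * ∏ k φ        ≡⟨ cong (φ k *_) (sym (f≡∏ pr k)) ⟩
  φ k * f pr k       ∎
  where
  φ : ℕ → ℤ
  φ i = + pr i - 1ℤ
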